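{- If $G$ is a $2$-connected finite simple graph containing no cycle of length $3$ and no cycle of length $5$, then $G$ is not vertex decomposable.
   Context: A graph is $2$-connected if it is connected, has at least three vertices and no cut vertex. $G$ is vertex decomposable if it has no edges, or there is a vertex $v$ such that $G\setminus v$ and $G\setminus N_G[v]$ (induced subgraphs on $V(G)\setminus\{v\}$ and on $V(G)$ minus $v$ and its neighbours) are vertex decomposable and no stable set of $G\setminus N_G[v]$ is a maximal stable set of $G\setminus v$. -}

module Defs where

open import Data.Nat using (ℕ; zero; suc; _≤_)
open import Data.Bool using (Bool; true; false; _∨_)
open import Data.Fin using (Fin; zero; suc; inject₁; fromℕ; _≟_)
open import Data.Fin.Subset using (Subset; _∈_; _∉_; _⊆_; ⊤; _-_; _─_)
open import Data.Vec using (tabulate)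
open import Data.Product using (Σ; _×_; _,_)
open import Function.Definitions using (Injective)
open import Relation.Binary.PropositionalEquality using (_≡_)
open import Relation.Nullary using (¬_)
open import Relation.Nullary.Decidable using (⌊_⌋)

record Graph (n : ℕ) : Set where
  field
    adj     : Fin n → Fin n → Bool
    adj-sym : ∀ u v → adj u v ≡ adj v u
    adj-irr : ∀ v → adj v v ≡ false
open Graph public

module _ {n : ℕ} (G : Graph n) where

  Adj : Fin n → Fin n → Set
  Adj u v = adj G u v ≡ true

  closedNbhd : Fin n → Subset n
  closedNbhd v = tabulate (λ u → ⌊ u ≟ v ⌋ ∨ adj G v u)

  -- Throughout, a vertex subset S stands for the induced subgraph G[S].

  NoEdges : Subset n → Set
  NoEdges S = ∀ u v → u ∈ S → v ∈ S → ¬ Adj u v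

  StableIn : Subset n → Subset n → Set
  StableIn S T = T ⊆ S × (∀ u v → u ∈ T → v ∈ T → ¬ Adj u v)

  MaximalStableIn : Subset n → Subset n → Set
  MaximalStableIn S T = StableIn S T × (∀ T′ → StableIn S T′ → T ⊆ T′ → T′ ⊆ T)

  data VertexDecomposableOn : Subset n → Set where
    noEdges  : ∀ {S} → NoEdges S → VertexDecomposableOn S
    shedding : ∀ {S} (v : Fin n) → v ∈ S →
               VertexDecomposableOn (S - v) →
               VertexDecomposableOn (S ─ closedNbhd v) →
               (∀ T → StableIn (S ─ closedNbhd v) T →
                      ¬ MaximalStableIn (S - v) T) →
               VertexDecomposableOn S

  VertexDecomposable : Set
  VertexDecomposable = VertexDecomposableOn ⊤

  data WalkIn (S : Subset n) : Fin n → Fin n → Set where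
    [] : ∀ {u} → u ∈ S → WalkIn S u u
    _∷_ : ∀ {u w v} → Adj u w → WalkIn S w v → u ∈ S → WalkIn S u v

  ConnectedOn : Subset n → Set
  ConnectedOn S = ∀ u v → u ∈ S → v ∈ S → WalkIn S u v

  TwoConnected : Set
  TwoConnected = 3 ≤ n × ConnectedOn ⊤ × (∀ v → ConnectedOn (⊤ - v))

  -- G contains a cycle of length suc m (m ≥ 2 in uses below): distinct
  -- vertices c₀, …, c_m with c_i ~ c_{i+1} and c_m ~ c₀.
  HasCycleOfLength : ℕ → Set
  HasCycleOfLength zero = Fin 0
  HasCycleOfLength (suc m) =
    Σ (Fin (suc m) → Fin n) λ c →
      Injective _≡_ _≡_ c ×
      (∀ (i : Fin m) → Adj (c (inject₁ i)) (c (suc i))) ×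
      Adj (c (fromℕ m)) (c zero)

-- Let v be any vertex and D the set of vertices at distance exactly two from v.
-- An edge inside D would close a cycle of length 3 or 5 through v, so D is a
-- stable set of G ∖ N[v]; extend it greedily to a maximal stable set T of
-- G ∖ N[v].  In a 2-connected graph every neighbour x of v has a second
-- neighbour w ≠ v, which lies in D since there is no triangle; hence T also
-- dominates N(v), and is therefore a maximal stable set of G ∖ v.  So no vertex
-- is a shedding vertex, and since G has an edge, G is not vertex decomposable.
module Submission where

open import Defs
open import Data.Bool using (true)
import Data.Bool as Bool
open import Data.Bool.Properties using (T-≡; ∨-zeroʳ)
open import Data.Empty using (⊥-elim)
open import Data.Fin using (Fin; zero; suc; inject₁; fromℕ)
open import Data.Fin.Properties using (_≟_; any?)
open import Data.Fin.Subset using (Subset; _∈_; _∉_; _⊆_; ⊤; _-_; _─_; _∪_; ⁅_⁆; inside; outside)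
open import Data.Fin.Subset.Properties
  using ( _∈?_; ∈⊤; x∈⁅x⁆; x∈⁅y⁆⇒x≡y; x∉⁅y⁆⇒x≢y; x∈p∪q⁻; p⊆p∪q; q⊆p∪q
        ; x∈p∧x∉q⇒x∈p─q; x∈p∧x≢y⇒x∈p-y; p─q⊆p )
open import Data.List using (List; []; _∷_; allFin)
open import Data.List.Membership.Propositional.Properties using (∈-allFin)
open import Data.List.Relation.Unary.All using (All; []; _∷_)
import Data.List.Relation.Unary.All as All
open import Data.Nat using (ℕ; zero; suc; _+_; s≤s)
open import Data.Product using (∃-syntax; ∃₂; _×_; _,_; proj₁; proj₂)
open import Data.Sum using (_⊎_; inj₁; inj₂)
import Data.Sum as Sum
open import Data.Vec using (Vec; []; _∷_; here; there; tabulate; lookup; head; last)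
open import Data.Vec.Properties using ([]=⇒lookup; lookup⇒[]=; lookup∘tabulate)
open import Data.Vec.Relation.Unary.All using ([]; _∷_)
open import Data.Vec.Relation.Unary.Linked using (Linked; [-]; _∷_)
open import Data.Vec.Relation.Unary.Unique.Propositional using (Unique; []; _∷_)
open import Data.Vec.Relation.Unary.Unique.Propositional.Properties using (lookup-injective)
open import Function using (id; _∘_)
open import Function.Bundles using (Equivalence)
open import Relation.Binary.PropositionalEquality
  using (_≡_; _≢_; refl; sym; trans; subst; cong; ≢-sym)
open import Relation.Nullary using (¬_; Dec; yes; no; _×-dec_; _⊎-dec_)
open import Relation.Nullary.Decidable using (⌊_⌋; toWitness; isYes≗does; dec-true)

x∈p─q⇒x∉q : ∀ {n} {x : Fin n} {p q : Subset n} → x ∈ p ─ q → x ∉ q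
x∈p─q⇒x∉q {p = inside ∷ _} {outside ∷ _} here ()
x∈p─q⇒x∉q {p = _ ∷ _} {_ ∷ _} (there x∈p─q) (there x∈q) = x∈p─q⇒x∉q x∈p─q x∈q

module _ {n : ℕ} {f : Fin n → Bool.Bool} where

  x∈tabulate⁻ : ∀ {x} → x ∈ tabulate f → f x ≡ true
  x∈tabulate⁻ {x} x∈ = trans (sym (lookup∘tabulate f x)) ([]=⇒lookup x∈)

  x∈tabulate⁺ : ∀ {x} → f x ≡ true → x ∈ tabulate f
  x∈tabulate⁺ {x} fx = lookup⇒[]= x (tabulate f) (trans (lookup∘tabulate f x) fx)

module _ {p} {P : Set p} (P? : Dec P) where

  ⌊⌋≡true⁺ : P → ⌊ P? ⌋ ≡ true
  ⌊⌋≡true⁺ x = trans (isYes≗does P?) (dec-true P? x)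

  ⌊⌋≡true⁻ : ⌊ P? ⌋ ≡ true → P
  ⌊⌋≡true⁻ e = toWitness (Equivalence.from T-≡ e)

module _ {a ℓ} {A : Set a} {R : A → A → Set ℓ} where

  Linked-lookup : ∀ {m} {xs : Vec A (suc m)} → Linked R xs →
                  ∀ (i : Fin m) → R (lookup xs (inject₁ i)) (lookup xs (suc i))
  Linked-lookup {xs = _ ∷ _ ∷ _} (r ∷ _) zero = r
  Linked-lookup (_ ∷ rs) (suc i) = Linked-lookup rs i

lookup-fromℕ : ∀ {a} {A : Set a} {m} (xs : Vec A (suc m)) → lookup xs (fromℕ m) ≡ last xs
lookup-fromℕ (x ∷ []) = refl
lookup-fromℕ (x ∷ y ∷ xs) = lookup-fromℕ (y ∷ xs)

avoidTwo : ∀ {m} (a b : Fin (3 + m)) → ∃[ y ] (y ≢ a × y ≢ b)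
avoidTwo a b with zero ≟ a | zero ≟ b
... | no 0≢a | no 0≢b = zero , 0≢a , 0≢b
... | yes refl | _ with suc zero ≟ b
...   | no 1≢b = suc zero , (λ ()) , 1≢b
...   | yes refl = suc (suc zero) , (λ ()) , (λ ())
avoidTwo a b | no _ | yes refl with suc zero ≟ a
...   | no 1≢a = suc zero , 1≢a , (λ ())
...   | yes refl = suc (suc zero) , (λ ()) , (λ ())

module _ {n : ℕ} (G : Graph n) where

  Adj-sym : ∀ {u v} → Adj G u v → Adj G v u
  Adj-sym {u} {v} uv = trans (adj-sym G v u) uv

  Adj⇒≢ : ∀ {u v} → Adj G u v → u ≢ v
  Adj⇒≢ {v = v} vv refl with trans (sym (adj-irr G v)) vv
  ... | ()

  Adj? : ∀ u v → Dec (Adj G u v)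
  Adj? u v = adj G u v Bool.≟ true

  v∈N[v] : ∀ v → v ∈ closedNbhd G v
  v∈N[v] v = x∈tabulate⁺ (cong (Bool._∨ adj G v v) (⌊⌋≡true⁺ (v ≟ v) refl))

  Adj⇒∈N[v] : ∀ {v x} → Adj G v x → x ∈ closedNbhd G v
  Adj⇒∈N[v] {v} {x} vx = x∈tabulate⁺ (trans (cong (⌊ x ≟ v ⌋ Bool.∨_) vx) (∨-zeroʳ _))

  ∈N[v]⇒≡⊎Adj : ∀ {v x} → x ∈ closedNbhd G v → x ≡ v ⊎ Adj G v x
  ∈N[v]⇒≡⊎Adj {v} {x} x∈N with x ≟ v | x∈tabulate⁻ x∈N
  ... | yes x≡v | _ = inj₁ x≡v
  ... | no _ | vx = inj₂ vx

  closedWalk⇒cycle : ∀ {m} (c : Vec (Fin n) (suc m)) → Unique c → Linked (Adj G) c →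
                     Adj G (last c) (head c) → HasCycleOfLength G (suc m)
  closedWalk⇒cycle {m} c@(_ ∷ _) unique linked closing =
      lookup c
    , (λ {i} {j} → lookup-injective unique i j)
    , Linked-lookup linked
    , subst (λ x → Adj G x (head c)) (sym (lookup-fromℕ c)) closing

  triangle : ∀ {a b c} → Adj G a b → Adj G b c → Adj G c a → HasCycleOfLength G 3
  triangle ab bc ca = closedWalk⇒cycle (_ ∷ _ ∷ _ ∷ [])
    ((Adj⇒≢ ab ∷ ≢-sym (Adj⇒≢ ca) ∷ []) ∷ (Adj⇒≢ bc ∷ []) ∷ [] ∷ [])
    (ab ∷ bc ∷ [-]) ca

  pentagon : ∀ {c₀ c₁ c₂ c₃ c₄} →
             Adj G c₀ c₁ → Adj G c₁ c₂ → Adj G c₂ c₃ → Adj G c₃ c₄ → Adj G c₄ c₀ →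
             c₀ ≢ c₂ → c₀ ≢ c₃ → c₁ ≢ c₃ → c₁ ≢ c₄ → c₂ ≢ c₄ → HasCycleOfLength G 5
  pentagon c₀c₁ c₁c₂ c₂c₃ c₃c₄ c₄c₀ c₀≢c₂ c₀≢c₃ c₁≢c₃ c₁≢c₄ c₂≢c₄ =
    closedWalk⇒cycle (_ ∷ _ ∷ _ ∷ _ ∷ _ ∷ [])
      (  (Adj⇒≢ c₀c₁ ∷ c₀≢c₂ ∷ c₀≢c₃ ∷ ≢-sym (Adj⇒≢ c₄c₀) ∷ [])
       ∷ (Adj⇒≢ c₁c₂ ∷ c₁≢c₃ ∷ c₁≢c₄ ∷ [])
       ∷ (Adj⇒≢ c₂c₃ ∷ c₂≢c₄ ∷ [])
       ∷ (Adj⇒≢ c₃c₄ ∷ [])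
       ∷ [] ∷ [])
      (c₀c₁ ∷ c₁c₂ ∷ c₂c₃ ∷ c₃c₄ ∷ [-]) c₄c₀

  walk-source∈ : ∀ {S u v} → WalkIn G S u v → u ∈ S
  walk-source∈ ([] u∈S) = u∈S
  walk-source∈ ((_ ∷ _) u∈S) = u∈S

  walk⇒step : ∀ {S u v} → WalkIn G S u v → u ≢ v → ∃[ w ] (Adj G u w × w ∈ S)
  walk⇒step ([] _) u≢u = ⊥-elim (u≢u refl)
  walk⇒step ((uw ∷ rest) _) _ = _ , uw , walk-source∈ rest

  TwoConnected⇒edge : TwoConnected G → ∃₂ (Adj G)
  TwoConnected⇒edge (s≤s (s≤s (s≤s _)) , connected , _)
    with walk⇒step (connected zero (suc zero) ∈⊤ ∈⊤) (λ ())
  ... | w , 0w , _ = zero , w , 0w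

  TwoConnected⇒otherNeighbour : TwoConnected G → ∀ {v x} → Adj G v x → ∃[ w ] (Adj G x w × w ≢ v)
  TwoConnected⇒otherNeighbour (s≤s (s≤s (s≤s _)) , _ , noCutVertex) {v} {x} vx
    with avoidTwo v x
  ... | y , y≢v , y≢x
    with walk⇒step (noCutVertex v x y (x∈p∧x≢y⇒x∈p-y ∈⊤ (≢-sym (Adj⇒≢ vx))) (x∈p∧x≢y⇒x∈p-y ∈⊤ y≢v))
                   (≢-sym y≢x)
  ... | w , xw , w∈G-v = w , xw , x∉⁅y⁆⇒x≢y (x∈p─q⇒x∉q w∈G-v)

  DominatedBy : Subset n → Fin n → Set
  DominatedBy T x = x ∈ T ⊎ ∃[ y ] (y ∈ T × Adj G x y)

  dominatedBy? : ∀ T x → Dec (DominatedBy T x)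
  dominatedBy? T x = x ∈? T ⊎-dec any? (λ y → y ∈? T ×-dec Adj? x y)

  dominatedBy-mono : ∀ {T T′ x} → T ⊆ T′ → DominatedBy T x → DominatedBy T′ x
  dominatedBy-mono T⊆T′ (inj₁ x∈T) = inj₁ (T⊆T′ x∈T)
  dominatedBy-mono T⊆T′ (inj₂ (y , y∈T , xy)) = inj₂ (y , T⊆T′ y∈T , xy)

  Dominates : Subset n → Subset n → Set
  Dominates T S = ∀ {x} → x ∈ S → DominatedBy T x

  stable∧dominating⇒maximal : ∀ {S T} → StableIn G S T → Dominates T S → MaximalStableIn G S T
  stable∧dominating⇒maximal {S} {T} stable dominating = stable , maximal
    where
    maximal : ∀ T′ → StableIn G S T′ → T ⊆ T′ → T′ ⊆ T
    maximal T′ (T′⊆S , independent′) T⊆T′ {x} x∈T′ with dominating (T′⊆S x∈T′)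
    ... | inj₁ x∈T = x∈T
    ... | inj₂ (y , y∈T , xy) = ⊥-elim (independent′ x y x∈T′ (T⊆T′ y∈T) xy)

  stable-∪-undominated : ∀ {S T x} → StableIn G S T → x ∈ S → ¬ DominatedBy T x →
                         StableIn G S (T ∪ ⁅ x ⁆)
  stable-∪-undominated {S} {T} {x} (T⊆S , independent) x∈S undominated = T∪x⊆S , independent′
    where
    ∈T∪x : ∀ {u} → u ∈ T ∪ ⁅ x ⁆ → u ∈ T ⊎ u ≡ x
    ∈T∪x u∈ = Sum.map₂ (x∈⁅y⁆⇒x≡y x) (x∈p∪q⁻ T ⁅ x ⁆ u∈)

    T∪x⊆S : T ∪ ⁅ x ⁆ ⊆ S
    T∪x⊆S u∈ with ∈T∪x u∈
    ... | inj₁ u∈T = T⊆S u∈T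
    ... | inj₂ refl = x∈S

    independent′ : ∀ u w → u ∈ T ∪ ⁅ x ⁆ → w ∈ T ∪ ⁅ x ⁆ → ¬ Adj G u w
    independent′ u w u∈ w∈ uw with ∈T∪x u∈ | ∈T∪x w∈
    ... | inj₁ u∈T | inj₁ w∈T = independent u w u∈T w∈T uw
    ... | inj₁ u∈T | inj₂ refl = undominated (inj₂ (u , u∈T , Adj-sym uw))
    ... | inj₂ refl | inj₁ w∈T = undominated (inj₂ (w , w∈T , uw))
    ... | inj₂ refl | inj₂ refl = Adj⇒≢ uw refl

  extendToDominate : ∀ {S T} (L : List (Fin n)) → StableIn G S T →
                     ∃[ T′ ] (T ⊆ T′ × StableIn G S T′ × All (λ x → x ∈ S → DominatedBy T′ x) L)
  extendToDominate [] stable = _ , id , stable , []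
  extendToDominate {S} (x ∷ L) stable with extendToDominate L stable
  ... | T₁ , T⊆T₁ , stable₁ , dominated₁ with x ∈? S | dominatedBy? T₁ x
  ... | no x∉S | _ = T₁ , T⊆T₁ , stable₁ , (λ x∈S → ⊥-elim (x∉S x∈S)) ∷ dominated₁
  ... | yes _ | yes x-dominated = T₁ , T⊆T₁ , stable₁ , (λ _ → x-dominated) ∷ dominated₁
  ... | yes x∈S | no x-undominated =
      T₁ ∪ ⁅ x ⁆
    , p⊆p∪q _ ∘ T⊆T₁
    , stable-∪-undominated stable₁ x∈S x-undominated
    , (λ _ → inj₁ (q⊆p∪q T₁ _ (x∈⁅x⁆ x)))
      ∷ All.map (dominatedBy-mono (p⊆p∪q _) ∘_) dominated₁

  extendToDominating : ∀ {S T} → StableIn G S T →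
                       ∃[ T′ ] (T ⊆ T′ × StableIn G S T′ × Dominates T′ S)
  extendToDominating stable with extendToDominate (allFin n) stable
  ... | T′ , T⊆T′ , stable′ , dominated =
    T′ , T⊆T′ , stable′ , λ {x} x∈S → All.lookup dominated (∈-allFin x) x∈S

  ∉N[v]⇒≢∧¬Adj : ∀ {v w} → w ∉ closedNbhd G v → v ≢ w × ¬ Adj G v w
  ∉N[v]⇒≢∧¬Adj {v} w∉N = (λ { refl → w∉N (v∈N[v] v) }) , w∉N ∘ Adj⇒∈N[v]

  secondNbhd : Fin n → Subset n
  secondNbhd v = tabulate (λ w → ⌊ any? (λ u → Adj? v u ×-dec Adj? u w) ⌋) ─ closedNbhd G v

  ∈secondNbhd⁺ : ∀ {v u w} → Adj G v u → Adj G u w → w ∉ closedNbhd G v → w ∈ secondNbhd v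
  ∈secondNbhd⁺ vu uw w∉N = x∈p∧x∉q⇒x∈p─q (x∈tabulate⁺ (⌊⌋≡true⁺ (any? _) (_ , vu , uw))) w∉N

  ∈secondNbhd⁻ : ∀ {v w} → w ∈ secondNbhd v →
                 (∃[ u ] (Adj G v u × Adj G u w)) × w ∉ closedNbhd G v
  ∈secondNbhd⁻ w∈ = ⌊⌋≡true⁻ (any? _) (x∈tabulate⁻ (p─q⊆p _ _ w∈)) , x∈p─q⇒x∉q w∈

  secondNbhd-stable : ¬ HasCycleOfLength G 3 → ¬ HasCycleOfLength G 5 →
                      ∀ v → StableIn G (⊤ ─ closedNbhd G v) (secondNbhd v)
  secondNbhd-stable no3 no5 v = secondNbhd⊆ , independent
    where
    secondNbhd⊆ : secondNbhd v ⊆ ⊤ ─ closedNbhd G v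
    secondNbhd⊆ w∈ = x∈p∧x∉q⇒x∈p─q ∈⊤ (proj₂ (∈secondNbhd⁻ w∈))

    independent : ∀ w₁ w₂ → w₁ ∈ secondNbhd v → w₂ ∈ secondNbhd v → ¬ Adj G w₁ w₂
    independent w₁ w₂ w₁∈ w₂∈ w₁w₂
      with ∈secondNbhd⁻ w₁∈ | ∈secondNbhd⁻ w₂∈
    ... | (u₁ , vu₁ , u₁w₁) , w₁∉N | (u₂ , vu₂ , u₂w₂) , w₂∉N
      with ∉N[v]⇒≢∧¬Adj w₁∉N | ∉N[v]⇒≢∧¬Adj w₂∉N | u₁ ≟ u₂
    ... | _ | _ | yes refl = no3 (triangle u₁w₁ w₁w₂ (Adj-sym u₂w₂))
    ... | v≢w₁ , ¬vw₁ | v≢w₂ , ¬vw₂ | no u₁≢u₂ =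
      no5 (pentagon vu₁ u₁w₁ w₁w₂ (Adj-sym u₂w₂) (Adj-sym vu₂)
                    v≢w₁ v≢w₂ (λ { refl → ¬vw₂ vu₁ }) u₁≢u₂ (λ { refl → ¬vw₁ vu₂ }))

  neighbour-dominatedBy-secondNbhd : TwoConnected G → ¬ HasCycleOfLength G 3 →
                                     ∀ {v x} → Adj G v x → DominatedBy (secondNbhd v) x
  neighbour-dominatedBy-secondNbhd twoConnected no3 {v} {x} vx
    with TwoConnected⇒otherNeighbour twoConnected vx
  ... | w , xw , w≢v = inj₂ (w , ∈secondNbhd⁺ vx xw w∉N , xw)
    where
    w∉N : w ∉ closedNbhd G v
    w∉N w∈N with ∈N[v]⇒≡⊎Adj w∈N
    ... | inj₁ w≡v = w≢v w≡v
    ... | inj₂ vw = no3 (triangle vx xw (Adj-sym vw))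

  IsShedding : Subset n → Fin n → Set
  IsShedding S v = ∀ T → StableIn G (S ─ closedNbhd G v) T → ¬ MaximalStableIn G (S - v) T

  noSheddingVertex : TwoConnected G → ¬ HasCycleOfLength G 3 → ¬ HasCycleOfLength G 5 →
                     ∀ v → ¬ IsShedding ⊤ v
  noSheddingVertex twoConnected no3 no5 v isShedding
    with extendToDominating (secondNbhd-stable no3 no5 v)
  ... | T , secondNbhd⊆T , stable@(T⊆G-N[v] , independent) , dominatesG-N[v] =
    isShedding T stable
      (stable∧dominating⇒maximal (G-N[v]⊆G-v ∘ T⊆G-N[v] , independent) dominatesG-v)
    where
    G-N[v]⊆G-v : ⊤ ─ closedNbhd G v ⊆ ⊤ - v
    G-N[v]⊆G-v x∈ = x∈p∧x≢y⇒x∈p-y ∈⊤ (≢-sym (proj₁ (∉N[v]⇒≢∧¬Adj (x∈p─q⇒x∉q x∈))))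

    dominatesG-v : Dominates T (⊤ - v)
    dominatesG-v {x} x∈G-v with x ∈? closedNbhd G v
    ... | no x∉N = dominatesG-N[v] (x∈p∧x∉q⇒x∈p─q ∈⊤ x∉N)
    ... | yes x∈N with ∈N[v]⇒≡⊎Adj x∈N
    ...   | inj₁ refl = ⊥-elim (x∉⁅y⁆⇒x≢y (x∈p─q⇒x∉q x∈G-v) refl)
    ...   | inj₂ vx =
      dominatedBy-mono secondNbhd⊆T (neighbour-dominatedBy-secondNbhd twoConnected no3 vx)

mainTheorem14 : ∀ {n : ℕ} (G : Graph n) →
                TwoConnected G →
                ¬ HasCycleOfLength G 3 →
                ¬ HasCycleOfLength G 5 →
                ¬ VertexDecomposable G
mainTheorem14 G twoConnected _ _ (noEdges noEdge) with TwoConnected⇒edge G twoConnected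
... | u , v , uv = noEdge u v ∈⊤ ∈⊤ uv
mainTheorem14 G twoConnected no3 no5 (shedding v _ _ _ isShedding) =
  noSheddingVertex G twoConnected no3 no5 v isShedding
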